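{- For every constant $\delta>0$ there is no fractional online algorithm for the online matching problem under adversarial edge arrivals that is $(\tfrac12+\delta)$-competitive; this holds even when the input graphs are restricted to be bipartite.
   Context: Online matching with edge arrivals: the edges of an unknown graph $G=(V,E)$ are revealed one at a time in an adversarial order. A fractional online algorithm must, immediately and irrevocably upon arrival of each edge $e$, assign it a value $x_e\ge 0$, such that at all times the vector $\vec x$ lies in the fractional matching polytope $\{\vec x\ge \vec 0 : \sum_{e\ni v}x_e\le 1 \ \forall v\in V\}$. (Any randomized online matching algorithm induces a fractional one by setting $x_e=\Pr[e \text{ is matched}]$.) The algorithm is $\alpha$-competitive if for every input graph and every arrival order, its value $\sum_e x_e$ is at least $\alpha$ times the size of a maximum matching of the graph; since the adversary may end the input at any time, this must hold for every prefix of the arrival sequence.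
   Formalization: The fractional online algorithms considered assign rational values $x_e$ to the edges, and the constant $\delta$ ranges over the positive rationals. -}

module Defs where

open import Data.Nat using (ℕ; _≡ᵇ_)
open import Data.Bool using (if_then_else_)
open import Data.Integer using (+_)
open import Data.Rational using (ℚ; 0ℚ; 1ℚ; _+_; _*_; _≤_; _/_)
open import Data.Product using (_×_; _,_; proj₁; proj₂)
open import Data.List using (List; []; _∷_; _++_; [_]; length; map; zip; foldr)
open import Data.List.Relation.Unary.All using (All)
open import Data.List.Relation.Unary.Unique.Propositional using (Unique)
open import Data.List.Membership.Propositional using (_∈_)
open import Relation.Binary.PropositionalEquality using (_≡_)

-- Bipartite graphs with edge arrivals: a vertex is either a left vertex
-- (a natural number) or a right vertex (a natural number); an edge is a
-- pair (u , v) of a left vertex u and a right vertex v.  An input is the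
-- list of edges in arrival order; it describes a simple graph iff the
-- list has no repeated edges.
Edge : Set
Edge = ℕ × ℕ

-- A (deterministic) fractional online algorithm: given the history of
-- previously arrived edges (in arrival order) and the newly arriving
-- edge, it irrevocably assigns a value to the new edge.  Since the
-- algorithm is deterministic, its past assignments are functions of the
-- history, so this captures full knowledge of its own past choices.
OnlineAlg : Set
OnlineAlg = List Edge → Edge → ℚ

assignFrom : OnlineAlg → List Edge → List Edge → List (Edge × ℚ)
assignFrom A hist []         = []
assignFrom A hist (e ∷ rest) = (e , A hist e) ∷ assignFrom A (hist ++ [ e ]) rest

assign : OnlineAlg → List Edge → List (Edge × ℚ)
assign A es = assignFrom A [] es

sumℚ : List ℚ → ℚ
sumℚ = foldr _+_ 0ℚ

loadL : List (Edge × ℚ) → ℕ → ℚ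
loadL []                  u = 0ℚ
loadL (((a , b) , x) ∷ r) u = if a ≡ᵇ u then x + loadL r u else loadL r u

loadR : List (Edge × ℚ) → ℕ → ℚ
loadR []                  v = 0ℚ
loadR (((a , b) , x) ∷ r) v = if b ≡ᵇ v then x + loadR r v else loadR r v

value : List (Edge × ℚ) → ℚ
value xs = sumℚ (map proj₂ xs)

ValidInput : List Edge → Set
ValidInput es = Unique es

Feasible : OnlineAlg → Set
Feasible A = ∀ (es : List Edge) → ValidInput es →
  All (λ p → 0ℚ ≤ proj₂ p) (assign A es)
  × (∀ u → loadL (assign A es) u ≤ 1ℚ)
  × (∀ v → loadR (assign A es) v ≤ 1ℚ)

IsMatching : List Edge → List Edge → Set
IsMatching es M = All (_∈ es) M × Unique (map proj₁ M) × Unique (map proj₂ M)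

ℕtoℚ : ℕ → ℚ
ℕtoℚ n = + n / 1

-- α-competitive: on every (prefix of every) input, the value is at least
-- α times the size of every matching, i.e. of a maximum matching.
Competitive : ℚ → OnlineAlg → Set
Competitive α A = ∀ (es : List Edge) → ValidInput es →
  ∀ (M : List Edge) → IsMatching es M →
  α * ℕtoℚ (length M) ≤ value (assign A es)

-- The core of the adversarial graph is the complete bipartite graph on
-- {0, …, k} × {0, …, k}, whose edges (a , b) arrive anti-diagonal by anti-diagonal,
-- a + b = t for t = 0, …, 2k + 1.  After anti-diagonal t the adversary may end the
-- input with one pendant edge at each of the first j = t ∸ k vertices of either side;
-- with anti-diagonal t these pendants form a matching of size t + 1, while the load
-- constraints cap the value on edges at those 2j vertices by 2j.  As the algorithm
-- has committed to the core values x_e before the threat, every stage t yields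
--   α (t + 1) ≤ 2j + Σ_{a + b ≤ t} x_{(a , b)} ([j ≤ a] + [j ≤ b] − 1).
-- Summed over all 2k + 2 stages the coefficient of every core edge cancels, leaving
-- α n (2n + 1) ≤ n (n + 1) for n = k + 1, which fails for α = ½ + δ once δ n ≥ 1.

module Submission where

open import Defs
open import Data.Product using (_×_; _,_; proj₁; proj₂; ∃)
open import Data.Sum using (_⊎_; inj₁; inj₂)
open import Data.Bool using (true; false; if_then_else_)
open import Data.List using (List; []; _∷_; _++_; length; applyUpTo)
import Data.List.Properties as List
open import Data.List.Relation.Unary.All as All using (All; []; _∷_)
import Data.List.Relation.Unary.All.Properties as All
open import Data.List.Relation.Unary.AllPairs as AllPairs using (AllPairs)
import Data.List.Relation.Unary.AllPairs.Properties as AllPairs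
open import Data.List.Relation.Unary.Unique.Propositional using (Unique)
open import Data.List.Membership.Propositional.Properties using (∈-++⁺ˡ; ∈-++⁺ʳ)
open import Function using (_on_)

open import Algebra.Bundles using (CommutativeMonoid)
open import Data.Nat as ℕ using (ℕ; zero; suc; _∸_; _≡ᵇ_; z≤n; s≤s)
import Data.Nat.Properties as ℕ
open import Data.Nat.Tactic.RingSolver using (solve-∀)
import Relation.Binary.PropositionalEquality as ≡
open import Relation.Nullary using (¬_; yes; no; contradiction)
open ≡ using (_≡_)

module RangeSum {c ℓ} (M : CommutativeMonoid c ℓ) where

  open CommutativeMonoid M
  open import Algebra.Properties.CommutativeSemigroup commutativeSemigroup using (interchange)
  open import Relation.Binary.Reasoning.Setoid setoid

  ∑ : ℕ → (ℕ → Carrier) → Carrier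
  ∑ zero    f = ε
  ∑ (suc K) f = ∑ K f ∙ f K

  ∑-cong : ∀ K {f g} → (∀ {t} → t ℕ.< K → f t ≈ g t) → ∑ K f ≈ ∑ K g
  ∑-cong zero    f≈g = refl
  ∑-cong (suc K) f≈g = ∙-cong (∑-cong K (λ t<K → f≈g (ℕ.m<n⇒m<1+n t<K))) (f≈g ℕ.≤-refl)

  ∑-zero : ∀ K → ∑ K (λ _ → ε) ≈ ε
  ∑-zero zero    = refl
  ∑-zero (suc K) = trans (identityʳ _) (∑-zero K)

  ∑-distrib : ∀ K f g → ∑ K (λ t → f t ∙ g t) ≈ ∑ K f ∙ ∑ K g
  ∑-distrib zero    f g = sym (identityˡ ε)
  ∑-distrib (suc K) f g = begin
    ∑ K (λ t → f t ∙ g t) ∙ (f K ∙ g K) ≈⟨ ∙-congʳ (∑-distrib K f g) ⟩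
    (∑ K f ∙ ∑ K g) ∙ (f K ∙ g K)       ≈⟨ interchange _ _ _ _ ⟩
    ∑ (suc K) f ∙ ∑ (suc K) g           ∎

  ∑-split : ∀ K L f → ∑ (K ℕ.+ L) f ≈ ∑ K f ∙ ∑ L (λ i → f (K ℕ.+ i))
  ∑-split K zero    f = begin
    ∑ (K ℕ.+ 0) f ≡⟨ ≡.cong (λ m → ∑ m f) (ℕ.+-identityʳ K) ⟩
    ∑ K f         ≈⟨ sym (identityʳ _) ⟩
    ∑ K f ∙ ε     ∎
  ∑-split K (suc L) f = begin
    ∑ (K ℕ.+ suc L) f                       ≡⟨ ≡.cong (λ m → ∑ m f) (ℕ.+-suc K L) ⟩
    ∑ (K ℕ.+ L) f ∙ f (K ℕ.+ L)             ≈⟨ ∙-congʳ (∑-split K L f) ⟩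
    (∑ K f ∙ ∑ L _) ∙ f (K ℕ.+ L)           ≈⟨ assoc _ _ _ ⟩
    ∑ K f ∙ ∑ (suc L) (λ i → f (K ℕ.+ i))   ∎

module ℕ∑ = RangeSum ℕ.+-0-commutativeMonoid

module Counting where

  open import Data.Nat
  open import Data.Nat.Properties
  open ℕ∑
  open ≡ using (_≡_; refl; sym; trans; cong; cong₂; module ≡-Reasoning)
  open ≡-Reasoning

  𝟙[_≤_] : ℕ → ℕ → ℕ
  𝟙[ zero  ≤ n     ] = 1
  𝟙[ suc m ≤ zero  ] = 0
  𝟙[ suc m ≤ suc n ] = 𝟙[ m ≤ n ]

  𝟙-yes : ∀ {m n} → m ≤ n → 𝟙[ m ≤ n ] ≡ 1
  𝟙-yes z≤n       = refl
  𝟙-yes (s≤s m≤n) = 𝟙-yes m≤n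

  𝟙-no : ∀ {m n} → ¬ m ≤ n → 𝟙[ m ≤ n ] ≡ 0
  𝟙-no {zero}          m≰n = contradiction z≤n m≰n
  𝟙-no {suc m} {zero}  m≰n = refl
  𝟙-no {suc m} {suc n} m≰n = 𝟙-no (λ m≤n → m≰n (s≤s m≤n))

  𝟙-complement : ∀ m n → 𝟙[ suc m ≤ n ] + 𝟙[ n ≤ m ] ≡ 1
  𝟙-complement m       zero    = refl
  𝟙-complement zero    (suc n) = refl
  𝟙-complement (suc m) (suc n) = 𝟙-complement m n

  𝟙-∸ : ∀ k t a → 𝟙[ t ∸ k ≤ a ] ≡ 𝟙[ t ≤ k + a ]
  𝟙-∸ zero    t       a = refl
  𝟙-∸ (suc k) zero    a = refl
  𝟙-∸ (suc k) (suc t) a = 𝟙-∸ k t a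

  count-from : ∀ K s → ∑ K (λ t → 𝟙[ s ≤ t ]) ≡ K ∸ s
  count-from zero    s = sym (0∸n≡0 s)
  count-from (suc K) s with s ≤? K
  ... | yes s≤K = begin
    ∑ K (λ t → 𝟙[ s ≤ t ]) + 𝟙[ s ≤ K ] ≡⟨ cong₂ _+_ (count-from K s) (𝟙-yes s≤K) ⟩
    K ∸ s + 1                           ≡⟨ +-comm (K ∸ s) 1 ⟩
    1 + (K ∸ s)                         ≡⟨ sym (+-∸-assoc 1 s≤K) ⟩
    suc K ∸ s                           ∎
  ... | no s≰K = begin
    ∑ K (λ t → 𝟙[ s ≤ t ]) + 𝟙[ s ≤ K ] ≡⟨ cong₂ _+_ (count-from K s) (𝟙-no s≰K) ⟩
    K ∸ s + 0                           ≡⟨ cong (_+ 0) (m≤n⇒m∸n≡0 (<⇒≤ (≰⇒> s≰K))) ⟩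
    0                                   ≡⟨ sym (m≤n⇒m∸n≡0 (≰⇒> s≰K)) ⟩
    suc K ∸ s                           ∎

  𝟙-≡ᵇ : ∀ a j → 𝟙[ suc a ≤ j ] + (if a ≡ᵇ j then 1 else 0) ≡ 𝟙[ a ≤ j ]
  𝟙-≡ᵇ zero    zero    = refl
  𝟙-≡ᵇ zero    (suc j) = refl
  𝟙-≡ᵇ (suc a) zero    = refl
  𝟙-≡ᵇ (suc a) (suc j) = 𝟙-≡ᵇ a j

  ∑-const : ∀ K c → ∑ K (λ _ → c) ≡ K * c
  ∑-const zero    c = refl
  ∑-const (suc K) c = trans (cong (_+ c) (∑-const K c)) (+-comm (K * c) c)

  ∑suc+∑suc≡n*[1+n] : ∀ n → ∑ n suc + ∑ n suc ≡ n * suc n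
  ∑suc+∑suc≡n*[1+n] zero    = refl
  ∑suc+∑suc≡n*[1+n] (suc n) = begin
    (∑ n suc + suc n) + (∑ n suc + suc n) ≡⟨ regroup (∑ n suc) (suc n) ⟩
    (∑ n suc + ∑ n suc) + (suc n + suc n) ≡⟨ cong (_+ (suc n + suc n)) (∑suc+∑suc≡n*[1+n] n) ⟩
    n * suc n + (suc n + suc n)           ≡⟨ expand n ⟩
    suc n * suc (suc n)                   ∎
    where
    regroup : ∀ x y → (x + y) + (x + y) ≡ (x + x) + (y + y)
    regroup = solve-∀
    expand : ∀ n → n * suc n + (suc n + suc n) ≡ suc n * suc (suc n)
    expand = solve-∀

  m<n∸o⇒m+o<n : ∀ {m n o} → m < n ∸ o → m + o < n
  m<n∸o⇒m+o<n {m} {n}     {zero}  m<n   = ≡.subst (_< n) (sym (+-identityʳ m)) m<n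
  m<n∸o⇒m+o<n {m} {suc n} {suc o} m<n∸o = ≡.subst (_< suc n) (sym (+-suc m o)) (s≤s (m<n∸o⇒m+o<n m<n∸o))

  complements-sum : ∀ x y {x′ y′ p} → x + x′ ≡ p → y + y′ ≡ p → x′ + y′ ≡ p → x + y ≡ p
  complements-sum x y {x′} {y′} {p} x+x′≡p y+y′≡p x′+y′≡p =
    trans (+-cancelʳ-≡ p (x + y) (x + x′) (begin
      (x + y) + p          ≡⟨ cong ((x + y) +_) (sym x′+y′≡p) ⟩
      (x + y) + (x′ + y′)  ≡⟨ interchange x y x′ y′ ⟩
      (x + x′) + (y + y′)  ≡⟨ cong ((x + x′) +_) y+y′≡p ⟩
      (x + x′) + p         ∎)) x+x′≡p
    where
    interchange : ∀ x y x′ y′ → (x + y) + (x′ + y′) ≡ (x + x′) + (y + y′)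
    interchange = solve-∀

  [m+n]∸[o+p]≡[m∸o]+[n∸p] : ∀ {m n o p} → o ≤ m → p ≤ n → (m + n) ∸ (o + p) ≡ (m ∸ o) + (n ∸ p)
  [m+n]∸[o+p]≡[m∸o]+[n∸p] {m} {n} {o} {p} o≤m p≤n = begin
    (m + n) ∸ (o + p) ≡⟨ sym (∸-+-assoc (m + n) o p) ⟩
    (m + n) ∸ o ∸ p   ≡⟨ cong (_∸ p) (+-∸-comm n o≤m) ⟩
    (m ∸ o + n) ∸ p   ≡⟨ +-∸-assoc (m ∸ o) p≤n ⟩
    m ∸ o + (n ∸ p)   ∎

  𝟙-window : ∀ {s h} t → s ≤ suc h → 𝟙[ s ≤ t ] * 𝟙[ t ≤ h ] + 𝟙[ suc h ≤ t ] ≡ 𝟙[ s ≤ t ]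
  𝟙-window {s} {h} t s≤1+h with t ≤? h
  ... | yes t≤h rewrite 𝟙-yes t≤h | 𝟙-no (<⇒≱ (s≤s t≤h)) = trans (+-identityʳ _) (*-identityʳ _)
  ... | no t≰h rewrite 𝟙-no t≰h | 𝟙-yes (≰⇒> t≰h) | 𝟙-yes (≤-trans s≤1+h (≰⇒> t≰h)) = refl

  count-window : ∀ K {s h} → s ≤ suc h → ∑ K (λ t → 𝟙[ s ≤ t ] * 𝟙[ t ≤ h ]) + (K ∸ suc h) ≡ K ∸ s
  count-window K {s} {h} s≤1+h = begin
    ∑ K (λ t → 𝟙[ s ≤ t ] * 𝟙[ t ≤ h ]) + (K ∸ suc h)
      ≡⟨ cong (∑ K _ +_) (sym (count-from K (suc h))) ⟩
    ∑ K (λ t → 𝟙[ s ≤ t ] * 𝟙[ t ≤ h ]) + ∑ K (λ t → 𝟙[ suc h ≤ t ])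
      ≡⟨ sym (∑-distrib K _ _) ⟩
    ∑ K (λ t → 𝟙[ s ≤ t ] * 𝟙[ t ≤ h ] + 𝟙[ suc h ≤ t ])
      ≡⟨ ∑-cong K (λ {t} _ → 𝟙-window t s≤1+h) ⟩
    ∑ K (λ t → 𝟙[ s ≤ t ])
      ≡⟨ count-from K s ⟩
    K ∸ s ∎

  -- The windows [a + b , k + a] and [a + b , k + b] of t have k + 1 − b and k + 1 − a
  -- elements, together as many as the stages t ≥ a + b below 2k + 2.
  balanced-count : ∀ k {a b} → a ≤ k → b ≤ k →
    ∑ (suc k + suc k) (λ t → 𝟙[ a + b ≤ t ] * (𝟙[ t ∸ k ≤ a ] + 𝟙[ t ∸ k ≤ b ]))
      ≡ ∑ (suc k + suc k) (λ t → 𝟙[ a + b ≤ t ])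
  balanced-count k {a} {b} a≤k b≤k = begin
    ∑ K (λ t → 𝟙[ s ≤ t ] * (𝟙[ t ∸ k ≤ a ] + 𝟙[ t ∸ k ≤ b ]))
      ≡⟨ ∑-cong K (λ {t} _ → split t) ⟩
    ∑ K (λ t → 𝟙[ s ≤ t ] * 𝟙[ t ≤ k + a ] + 𝟙[ s ≤ t ] * 𝟙[ t ≤ k + b ])
      ≡⟨ ∑-distrib K _ _ ⟩
    ∑ K (λ t → 𝟙[ s ≤ t ] * 𝟙[ t ≤ k + a ]) + ∑ K (λ t → 𝟙[ s ≤ t ] * 𝟙[ t ≤ k + b ])
      ≡⟨ complements-sum (∑ K _) (∑ K _) (count-window K s≤1+k+a) (count-window K s≤1+k+b) beyond ⟩
    K ∸ s
      ≡⟨ sym (count-from K s) ⟩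
    ∑ K (λ t → 𝟙[ s ≤ t ]) ∎
    where
    K = suc k + suc k
    s = a + b
    split : ∀ t → 𝟙[ s ≤ t ] * (𝟙[ t ∸ k ≤ a ] + 𝟙[ t ∸ k ≤ b ])
                  ≡ 𝟙[ s ≤ t ] * 𝟙[ t ≤ k + a ] + 𝟙[ s ≤ t ] * 𝟙[ t ≤ k + b ]
    split t = trans (cong₂ (λ x y → 𝟙[ s ≤ t ] * (x + y)) (𝟙-∸ k t a) (𝟙-∸ k t b))
                    (*-distribˡ-+ 𝟙[ s ≤ t ] _ _)
    s≤1+k+a : s ≤ suc (k + a)
    s≤1+k+a = m≤n⇒m≤1+n (≤-trans (+-monoʳ-≤ a b≤k) (≤-reflexive (+-comm a k)))
    s≤1+k+b : s ≤ suc (k + b)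
    s≤1+k+b = m≤n⇒m≤1+n (+-monoˡ-≤ b a≤k)
    beyond : (K ∸ suc (k + a)) + (K ∸ suc (k + b)) ≡ K ∸ s
    beyond = begin
      (K ∸ (suc k + a)) + (K ∸ (suc k + b))
        ≡⟨ cong₂ _+_ ([m+n]∸[m+o]≡n∸o (suc k) (suc k) a) ([m+n]∸[m+o]≡n∸o (suc k) (suc k) b) ⟩
      (suc k ∸ a) + (suc k ∸ b)
        ≡⟨ sym ([m+n]∸[o+p]≡[m∸o]+[n∸p] (m≤n⇒m≤1+n a≤k) (m≤n⇒m≤1+n b≤k)) ⟩
      K ∸ s ∎

open Counting

separated : ∀ {A : Set} {P Q : A → Set} {R : A → A → Set} {xs ys : List A} →
            All P xs → All Q ys → (∀ {x y} → P x → Q y → R x y) → All (λ x → All (R x) ys) xs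
separated ps qs sep = All.map (λ px → All.map (sep px) qs) ps

level : Edge → ℕ
level (a , b) = a ℕ.+ b

endsBelow endsAtLeast : ℕ → Edge → ℕ
endsBelow   j (a , b) = 𝟙[ suc a ≤ j ] ℕ.+ 𝟙[ suc b ≤ j ]
endsAtLeast j (a , b) = 𝟙[ j ≤ a ] ℕ.+ 𝟙[ j ≤ b ]

endsBelow+endsAtLeast≡2 : ∀ j e → endsBelow j e ℕ.+ endsAtLeast j e ≡ 2
endsBelow+endsAtLeast≡2 j (a , b) = ≡.trans (interchange 𝟙[ suc a ≤ j ] 𝟙[ suc b ≤ j ] 𝟙[ j ≤ a ] 𝟙[ j ≤ b ])
  (≡.cong₂ ℕ._+_ (𝟙-complement a j) (𝟙-complement b j))
  where
  interchange : ∀ w x y z → (w ℕ.+ x) ℕ.+ (y ℕ.+ z) ≡ (w ℕ.+ y) ℕ.+ (x ℕ.+ z)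
  interchange = solve-∀

module Adversary (k : ℕ) where

  open import Data.Nat
  open import Data.Nat.Properties
  open ≡ using (_≡_; _≢_; refl; sym; trans; cong; cong₂; subst; module ≡-Reasoning)
  open ℕ∑

  n stages : ℕ
  n      = suc k
  stages = n + n

  lo hi : ℕ → ℕ
  lo t = t ∸ k
  hi t = k ⊓ t

  width : ℕ → ℕ
  width t = suc (hi t) ∸ lo t

  diagonalEdge : ℕ → ℕ → Edge
  diagonalEdge t i = (lo t + i , hi t ∸ i)

  diagonal : ℕ → List Edge
  diagonal t = applyUpTo (diagonalEdge t) (width t)

  prefix : ℕ → List Edge
  prefix zero    = []
  prefix (suc t) = prefix t ++ diagonal t

  -- One pendant edge at each of the first j vertices of either side; its other
  -- endpoint n + u lies outside the core.
  pendants : ℕ → List Edge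
  pendants j = applyUpTo (λ u → (u , n + u)) j ++ applyUpTo (λ v → (n + v , v)) j

  Core : Edge → Set
  Core (a , b) = a ≤ k × b ≤ k

  Within : ℕ → ℕ → Set
  Within t x = lo t ≤ x × x ≤ k

  Outside : ℕ → ℕ → Set
  Outside j x = x < j ⊎ n ≤ x

  lo+i≤hi : ∀ t {i} → i < width t → lo t + i ≤ hi t
  lo+i≤hi t {i} i<w = subst (_≤ hi t) (+-comm i (lo t)) (≤-pred (m<n∸o⇒m+o<n i<w))

  diagonal-edges : ∀ t → All (λ e → level e ≡ t × Within t (proj₁ e) × Within t (proj₂ e)) (diagonal t)
  diagonal-edges t = All.applyUpTo⁺₁ (diagonalEdge t) (width t) edge
    where
    open ≡-Reasoning
    edge : ∀ {i} → i < width t →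
           (lo t + i) + (hi t ∸ i) ≡ t × Within t (lo t + i) × Within t (hi t ∸ i)
    edge {i} i<w = level≡t , (m≤m+n (lo t) i , ≤-trans in-range (m⊓n≤m k t))
                           , (m+n≤o⇒m≤o∸n (lo t) in-range , ≤-trans (m∸n≤m (hi t) i) (m⊓n≤m k t))
      where
      in-range = lo+i≤hi t i<w
      level≡t = begin
        (lo t + i) + (hi t ∸ i) ≡⟨ +-assoc (lo t) i _ ⟩
        lo t + (i + (hi t ∸ i)) ≡⟨ cong (lo t +_) (m+[n∸m]≡n (m+n≤o⇒n≤o (lo t) in-range)) ⟩
        lo t + hi t             ≡⟨ +-comm (lo t) (hi t) ⟩
        hi t + lo t             ≡⟨ m⊓n+n∸m≡n k t ⟩
        t                       ∎

  diagonal-firsts-distinct : ∀ t → AllPairs (_≢_ on proj₁) (diagonal t)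
  diagonal-firsts-distinct t = AllPairs.applyUpTo⁺₁ (diagonalEdge t) (width t)
    (λ i<j _ eq → <⇒≢ i<j (+-cancelˡ-≡ (lo t) _ _ eq))

  diagonal-seconds-distinct : ∀ t → AllPairs (_≢_ on proj₂) (diagonal t)
  diagonal-seconds-distinct t = AllPairs.applyUpTo⁺₁ (diagonalEdge t) (width t) (λ i<j j<w eq →
    <⇒≢ i<j (∸-cancelˡ-≡ (i≤hi (<-trans i<j j<w)) (i≤hi j<w) eq))
    where
    i≤hi : ∀ {i} → i < width t → i ≤ hi t
    i≤hi i<w = m+n≤o⇒n≤o (lo t) (lo+i≤hi t i<w)

  prefix-edges : ∀ t → All (λ e → level e < t × Core e) (prefix t)
  prefix-edges zero    = []
  prefix-edges (suc t) = All.++⁺ (All.map (λ (lt , core) → m<n⇒m<1+n lt , core) (prefix-edges t))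
    (All.map (λ (eq , (_ , a≤k) , (_ , b≤k)) → ≤-reflexive (cong suc eq) , a≤k , b≤k) (diagonal-edges t))

  prefix-unique : ∀ t → Unique (prefix t)
  prefix-unique zero    = AllPairs.[]
  prefix-unique (suc t) = AllPairs.++⁺ (prefix-unique t)
    (AllPairs.map (λ ne eq → ne (cong proj₁ eq)) (diagonal-firsts-distinct t))
    (separated (prefix-edges t) (diagonal-edges t)
      (λ (lt , _) (eq , _) e≡e′ → <⇒≢ lt (trans (cong level e≡e′) eq)))

  pendants-endsBelow : ∀ {j} → j ≤ n → All (λ e → endsBelow j e ≡ 1) (pendants j)
  pendants-endsBelow {j} j≤n = All.++⁺
    (All.applyUpTo⁺₁ _ j (λ {u} u<j → cong₂ _+_ (𝟙-yes u<j) (𝟙-no (far u))))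
    (All.applyUpTo⁺₁ _ j (λ {v} v<j → cong₂ _+_ (𝟙-no (far v)) (𝟙-yes v<j)))
    where
    far : ∀ u → ¬ suc (n + u) ≤ j
    far u = <⇒≱ (s≤s (≤-trans j≤n (m≤m+n n u)))

  pendants-outer : ∀ j → All (λ e → n ≤ proj₁ e ⊎ n ≤ proj₂ e) (pendants j)
  pendants-outer j = All.++⁺ (All.applyUpTo⁺₂ _ j (λ u → inj₂ (m≤m+n n u)))
                             (All.applyUpTo⁺₂ _ j (λ v → inj₁ (m≤m+n n v)))

  pendants-firsts : ∀ j → All (λ e → Outside j (proj₁ e)) (pendants j)
  pendants-firsts j = All.++⁺ (All.applyUpTo⁺₁ _ j inj₁) (All.applyUpTo⁺₂ _ j (λ v → inj₂ (m≤m+n n v)))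

  pendants-seconds : ∀ j → All (λ e → Outside j (proj₂ e)) (pendants j)
  pendants-seconds j = All.++⁺ (All.applyUpTo⁺₂ _ j (λ u → inj₂ (m≤m+n n u))) (All.applyUpTo⁺₁ _ j inj₁)

  private
    <≤-separated : ∀ {j x y} → j ≤ n → x < j → n ≤ y → x ≢ y
    <≤-separated j≤n x<j n≤y refl = <⇒≱ x<j (≤-trans j≤n n≤y)

  pendants-firsts-distinct : ∀ {j} → j ≤ n → AllPairs (_≢_ on proj₁) (pendants j)
  pendants-firsts-distinct {j} j≤n = AllPairs.++⁺
    (AllPairs.applyUpTo⁺₁ _ j (λ i<i′ _ → <⇒≢ i<i′))
    (AllPairs.applyUpTo⁺₁ _ j (λ i<i′ _ eq → <⇒≢ i<i′ (+-cancelˡ-≡ n _ _ eq)))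
    (separated (All.applyUpTo⁺₁ _ j (λ u<j → u<j)) (All.applyUpTo⁺₂ _ j (λ v → m≤m+n n v)) (<≤-separated j≤n))

  pendants-seconds-distinct : ∀ {j} → j ≤ n → AllPairs (_≢_ on proj₂) (pendants j)
  pendants-seconds-distinct {j} j≤n = AllPairs.++⁺
    (AllPairs.applyUpTo⁺₁ _ j (λ i<i′ _ eq → <⇒≢ i<i′ (+-cancelˡ-≡ n _ _ eq)))
    (AllPairs.applyUpTo⁺₁ _ j (λ i<i′ _ → <⇒≢ i<i′))
    (separated (All.applyUpTo⁺₂ _ j (λ u → m≤m+n n u)) (All.applyUpTo⁺₁ _ j (λ v<j → v<j))
           (λ n≤x y<j x≡y → <≤-separated j≤n y<j n≤x (sym x≡y)))

  pendants-length : ∀ j → length (pendants j) ≡ j + j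
  pendants-length j = trans (List.length-++ (applyUpTo _ j))
    (cong₂ _+_ (List.length-applyUpTo _ j) (List.length-applyUpTo _ j))

  pendants-unique : ∀ {j} → j ≤ n → Unique (pendants j)
  pendants-unique j≤n = AllPairs.map (λ ne eq → ne (cong proj₁ eq)) (pendants-firsts-distinct j≤n)

  prefix-pendants-unique : ∀ t {j} → j ≤ n → Unique (prefix t ++ pendants j)
  prefix-pendants-unique t {j} j≤n = AllPairs.++⁺ (prefix-unique t) (pendants-unique j≤n)
    (separated (prefix-edges t) (pendants-outer j) core≢outer)
    where
    core≢outer : ∀ {e e′} → level e < t × Core e → n ≤ proj₁ e′ ⊎ n ≤ proj₂ e′ → e ≢ e′
    core≢outer (_ , a≤k , _) (inj₁ n≤a′) refl = <⇒≱ (s≤s a≤k) n≤a′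
    core≢outer (_ , _ , b≤k) (inj₂ n≤b′) refl = <⇒≱ (s≤s b≤k) n≤b′

  lo≤1+hi : ∀ {t} → t < stages → lo t ≤ suc (hi t)
  lo≤1+hi {t} t<N = ⊓-glb (m≤n+o⇒m∸n≤o t k (≤-pred t<N)) (≤-trans (m∸n≤m t k) (n≤1+n t))

  lo≤n : ∀ {t} → t < stages → lo t ≤ n
  lo≤n t<N = ≤-trans (lo≤1+hi t<N) (s≤s (m⊓n≤m k _))

  stage-length : ∀ {t} → t < stages → length (pendants (lo t) ++ diagonal t) ≡ suc t
  stage-length {t} t<N = begin
    length (pendants (lo t) ++ diagonal t)
      ≡⟨ List.length-++ (pendants (lo t)) ⟩
    length (pendants (lo t)) + length (diagonal t)
      ≡⟨ cong₂ _+_ (pendants-length (lo t)) (List.length-applyUpTo (diagonalEdge t) (width t)) ⟩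
    (lo t + lo t) + width t              ≡⟨ +-assoc (lo t) (lo t) (width t) ⟩
    lo t + (lo t + (suc (hi t) ∸ lo t))  ≡⟨ cong (lo t +_) (m+[n∸m]≡n (lo≤1+hi t<N)) ⟩
    lo t + suc (hi t)                    ≡⟨ +-suc (lo t) (hi t) ⟩
    suc (lo t + hi t)                    ≡⟨ cong suc (trans (+-comm (lo t) (hi t)) (m⊓n+n∸m≡n k t)) ⟩
    suc t                                ∎
    where open ≡-Reasoning

  stage-matching : ∀ {t} → t < stages →
    IsMatching (prefix (suc t) ++ pendants (lo t)) (pendants (lo t) ++ diagonal t)
  stage-matching {t} t<N =
    All.++⁺ (All.tabulate (∈-++⁺ʳ (prefix (suc t))))
            (All.tabulate (λ e∈ → ∈-++⁺ˡ (∈-++⁺ʳ (prefix t) e∈))) ,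
    AllPairs.map⁺ (AllPairs.++⁺ (pendants-firsts-distinct (lo≤n t<N)) (diagonal-firsts-distinct t)
      (separated (pendants-firsts (lo t)) (diagonal-edges t) (λ x∉ (_ , y∈ , _) → outside≢within x∉ y∈))) ,
    AllPairs.map⁺ (AllPairs.++⁺ (pendants-seconds-distinct (lo≤n t<N)) (diagonal-seconds-distinct t)
      (separated (pendants-seconds (lo t)) (diagonal-edges t) (λ x∉ (_ , _ , y∈) → outside≢within x∉ y∈)))
    where
    outside≢within : ∀ {x y} → Outside (lo t) x → Within t y → x ≢ y
    outside≢within (inj₁ x<lo) (lo≤y , _) refl = <⇒≱ x<lo lo≤y
    outside≢within (inj₂ n≤x) (_ , y≤k) refl = <⇒≱ (s≤s y≤k) n≤x

  ∑-lo : ∑ stages lo ≡ ∑ n suc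
  ∑-lo = begin
    ∑ stages lo                       ≡⟨ ∑-split n n lo ⟩
    ∑ n lo + ∑ n (λ i → lo (n + i))
      ≡⟨ cong₂ _+_ (trans (∑-cong n lo≡0) (∑-zero n)) (∑-cong n (λ {i} _ → lo[n+i]≡1+i i)) ⟩
    0 + ∑ n suc                       ≡⟨⟩
    ∑ n suc                           ∎
    where
    open ≡-Reasoning
    lo≡0 : ∀ {t} → t < n → lo t ≡ 0
    lo≡0 t<n = m≤n⇒m∸n≡0 (≤-pred t<n)
    lo[n+i]≡1+i : ∀ i → lo (n + i) ≡ suc i
    lo[n+i]≡1+i i = trans (cong (_∸ k) (sym (+-suc k i))) (m+n∸m≡n k (suc i))

  ∑-stage-size : ∑ stages suc ≡ n * suc stages
  ∑-stage-size = begin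
    ∑ stages suc                                 ≡⟨ ∑-split n n suc ⟩
    ∑ n suc + ∑ n (λ i → suc (n + i))            ≡⟨ cong (∑ n suc +_) (∑-cong n (λ {i} _ → sym (+-suc n i))) ⟩
    ∑ n suc + ∑ n (λ i → n + suc i)              ≡⟨ cong (∑ n suc +_) (∑-distrib n (λ _ → n) suc) ⟩
    ∑ n suc + (∑ n (λ _ → n) + ∑ n suc)          ≡⟨ cong (λ x → ∑ n suc + (x + ∑ n suc)) (∑-const n n) ⟩
    ∑ n suc + (n * n + ∑ n suc)                  ≡⟨ regroup (∑ n suc) (n * n) ⟩
    n * n + (∑ n suc + ∑ n suc)                  ≡⟨ cong (n * n +_) (∑suc+∑suc≡n*[1+n] n) ⟩
    n * n + n * suc n                            ≡⟨ expand n ⟩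
    n * suc stages                               ∎
    where
    open ≡-Reasoning
    regroup : ∀ x y → x + (y + x) ≡ y + (x + x)
    regroup = solve-∀
    expand : ∀ n → n * n + n * suc n ≡ n * suc (n + n)
    expand = solve-∀

  ∑-threat-size : ∑ stages (λ t → lo t + lo t) ≡ n * suc n
  ∑-threat-size = trans (∑-distrib stages lo lo) (trans (cong₂ _+_ ∑-lo ∑-lo) (∑suc+∑suc≡n*[1+n] n))

-- Opened only here: the modules above use the ℕ operators of the same names unqualified.
open import Data.Rational using (ℚ; 0ℚ; 1ℚ; ½; _+_; _*_; -_; _≤_; _<_; mkℚ; toℚᵘ; *<*; nonNegative)
import Data.Rational.Properties as ℚ
import Data.Rational.Unnormalised as ℚᵘ
import Data.Rational.Unnormalised.Properties as ℚᵘ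
open import Data.Rational.Solver using (module +-*-Solver)
open import Data.Integer as ℤ using (+[1+_]; -[1+_])
import Data.Integer.Properties as ℤ
import Data.Nat.Coprimality as Coprime
open ≡ using (refl; sym; trans; cong; cong₂; subst; subst₂; module ≡-Reasoning)

ℕtoℚ≡mkℚ : ∀ m → ℕtoℚ m ≡ mkℚ (ℤ.+ m) 0 (Coprime.sym (Coprime.1-coprimeTo m))
ℕtoℚ≡mkℚ m = ℚ.normalize-coprime (Coprime.sym (Coprime.1-coprimeTo m))

toℚᵘ-ℕtoℚ : ∀ m → toℚᵘ (ℕtoℚ m) ≡ ℚᵘ.mkℚᵘ (ℤ.+ m) 0
toℚᵘ-ℕtoℚ m = cong toℚᵘ (ℕtoℚ≡mkℚ m)

ℕtoℚ-+ : ∀ m n → ℕtoℚ (m ℕ.+ n) ≡ ℕtoℚ m + ℕtoℚ n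
ℕtoℚ-+ m n = ℚ.toℚᵘ-injective (begin
  toℚᵘ (ℕtoℚ (m ℕ.+ n))                       ≡⟨ toℚᵘ-ℕtoℚ (m ℕ.+ n) ⟩
  ℚᵘ.mkℚᵘ (ℤ.+ (m ℕ.+ n)) 0                     ≈⟨ ℚᵘ.*≡* numerators ⟩
  ℚᵘ.mkℚᵘ (ℤ.+ m) 0 ℚᵘ.+ ℚᵘ.mkℚᵘ (ℤ.+ n) 0        ≡⟨ sym (cong₂ ℚᵘ._+_ (toℚᵘ-ℕtoℚ m) (toℚᵘ-ℕtoℚ n)) ⟩
  toℚᵘ (ℕtoℚ m) ℚᵘ.+ toℚᵘ (ℕtoℚ n)            ≈⟨ ℚᵘ.≃-sym (ℚ.toℚᵘ-homo-+ (ℕtoℚ m) (ℕtoℚ n)) ⟩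
  toℚᵘ (ℕtoℚ m + ℕtoℚ n)                      ∎)
  where
  open ℚᵘ.≃-Reasoning
  numerators : ℤ.+ (m ℕ.+ n) ℤ.* ℤ.+ 1 ≡ (ℤ.+ m ℤ.* ℤ.+ 1 ℤ.+ ℤ.+ n ℤ.* ℤ.+ 1) ℤ.* ℤ.+ 1
  numerators = trans (ℤ.*-identityʳ _) (trans (ℤ.pos-+ m n) (sym (trans (ℤ.*-identityʳ _)
                 (cong₂ ℤ._+_ (ℤ.*-identityʳ (ℤ.+ m)) (ℤ.*-identityʳ (ℤ.+ n))))))

ℕtoℚ-* : ∀ m n → ℕtoℚ (m ℕ.* n) ≡ ℕtoℚ m * ℕtoℚ n
ℕtoℚ-* m n = ℚ.toℚᵘ-injective (begin
  toℚᵘ (ℕtoℚ (m ℕ.* n))                       ≡⟨ toℚᵘ-ℕtoℚ (m ℕ.* n) ⟩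
  ℚᵘ.mkℚᵘ (ℤ.+ (m ℕ.* n)) 0                     ≈⟨ ℚᵘ.*≡* (cong (ℤ._* ℤ.+ 1) (ℤ.pos-* m n)) ⟩
  ℚᵘ.mkℚᵘ (ℤ.+ m) 0 ℚᵘ.* ℚᵘ.mkℚᵘ (ℤ.+ n) 0        ≡⟨ sym (cong₂ ℚᵘ._*_ (toℚᵘ-ℕtoℚ m) (toℚᵘ-ℕtoℚ n)) ⟩
  toℚᵘ (ℕtoℚ m) ℚᵘ.* toℚᵘ (ℕtoℚ n)            ≈⟨ ℚᵘ.≃-sym (ℚ.toℚᵘ-homo-* (ℕtoℚ m) (ℕtoℚ n)) ⟩
  toℚᵘ (ℕtoℚ m * ℕtoℚ n)                      ∎)
  where open ℚᵘ.≃-Reasoning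

ℕtoℚ-cancel-≤ : ∀ {m n} → ℕtoℚ m ≤ ℕtoℚ n → m ℕ.≤ n
ℕtoℚ-cancel-≤ {m} {n} le with ℚ.toℚᵘ-mono-≤ le
... | ℚᵘ.*≤* le′ rewrite toℚᵘ-ℕtoℚ m | toℚᵘ-ℕtoℚ n =
  ℤ.drop‿+≤+ (subst₂ ℤ._≤_ (ℤ.*-identityʳ (ℤ.+ m)) (ℤ.*-identityʳ (ℤ.+ n)) le′)

0≤ℕtoℚ : ∀ m → 0ℚ ≤ ℕtoℚ m
0≤ℕtoℚ m rewrite ℕtoℚ≡mkℚ m = ℚ.nonNegative⁻¹ _

archimedean : ∀ δ → 0ℚ < δ → ∃ λ k → 1ℚ ≤ δ * ℕtoℚ (suc k)
archimedean δ@(mkℚ +[1+ p ] d _) _ = d , ℚ.toℚᵘ-cancel-≤ (begin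
  toℚᵘ 1ℚ                               ≤⟨ ℚᵘ.*≤* (ℤ.+≤+ (s≤s 1+d≤[1+p][1+d])) ⟩
  toℚᵘ δ ℚᵘ.* ℚᵘ.mkℚᵘ (ℤ.+ suc d) 0       ≡⟨ cong (toℚᵘ δ ℚᵘ.*_) (sym (toℚᵘ-ℕtoℚ (suc d))) ⟩
  toℚᵘ δ ℚᵘ.* toℚᵘ (ℕtoℚ (suc d))       ≃⟨ ℚᵘ.≃-sym (ℚ.toℚᵘ-homo-* δ (ℕtoℚ (suc d))) ⟩
  toℚᵘ (δ * ℕtoℚ (suc d))               ∎)
  where
  open ℚᵘ.≤-Reasoning
  1+d≤[1+p][1+d] : d ℕ.* 1 ℕ.+ 0 ℕ.≤ (d ℕ.+ p ℕ.* suc d) ℕ.* 1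
  1+d≤[1+p][1+d] = subst₂ ℕ._≤_ (sym (trans (ℕ.+-identityʳ _) (ℕ.*-identityʳ d))) (sym (ℕ.*-identityʳ _))
                     (ℕ.m≤m+n d (p ℕ.* suc d))
archimedean (mkℚ (ℤ.+ 0)      _ _) (*<* (ℤ.+<+ ()))
archimedean (mkℚ -[1+ _ ]   _ _) (*<* ())

module ℚ∑ = RangeSum ℚ.+-0-commutativeMonoid
open ℚ∑

∑-mono : ∀ K {f g} → (∀ {t} → t ℕ.< K → f t ≤ g t) → ∑ K f ≤ ∑ K g
∑-mono zero    f≤g = ℚ.≤-refl
∑-mono (suc K) f≤g = ℚ.+-mono-≤ (∑-mono K (λ t<K → f≤g (ℕ.m<n⇒m<1+n t<K))) (f≤g ℕ.≤-refl)

∑-*ˡ : ∀ K c f → ∑ K (λ t → c * f t) ≡ c * ∑ K f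
∑-*ˡ zero    c f = sym (ℚ.*-zeroʳ c)
∑-*ˡ (suc K) c f = trans (cong (_+ c * f K) (∑-*ˡ K c f)) (sym (ℚ.*-distribˡ-+ c (∑ K f) (f K)))

ℕtoℚ-∑ : ∀ K f → ℕtoℚ (ℕ∑.∑ K f) ≡ ∑ K (λ t → ℕtoℚ (f t))
ℕtoℚ-∑ zero    f = refl
ℕtoℚ-∑ (suc K) f = trans (ℕtoℚ-+ (ℕ∑.∑ K f) (f K)) (cong (_+ ℕtoℚ (f K)) (ℕtoℚ-∑ K f))

∑≤ℕtoℚ : ∀ K {f} → (∀ t → f t ≤ 1ℚ) → ∑ K f ≤ ℕtoℚ K
∑≤ℕtoℚ zero    f≤1 = ℚ.≤-refl
∑≤ℕtoℚ (suc K) {f} f≤1 = subst (∑ K f + f K ≤_) (trans (sym (ℕtoℚ-+ K 1)) (cong ℕtoℚ (ℕ.+-comm K 1)))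
  (ℚ.+-mono-≤ (∑≤ℕtoℚ K f≤1) (f≤1 K))

∑-indicator : ∀ j a x → ∑ j (λ u → if a ≡ᵇ u then x else 0ℚ) ≡ ℕtoℚ 𝟙[ suc a ≤ j ] * x
∑-indicator zero    a x = sym (ℚ.*-zeroˡ x)
∑-indicator (suc j) a x = begin
  ∑ j (λ u → if a ≡ᵇ u then x else 0ℚ) + (if a ≡ᵇ j then x else 0ℚ)
    ≡⟨ cong₂ _+_ (∑-indicator j a x) (if-scale (a ≡ᵇ j)) ⟩
  ℕtoℚ 𝟙[ suc a ≤ j ] * x + ℕtoℚ (if a ≡ᵇ j then 1 else 0) * x
    ≡⟨ sym (ℚ.*-distribʳ-+ x (ℕtoℚ 𝟙[ suc a ≤ j ]) (ℕtoℚ (if a ≡ᵇ j then 1 else 0))) ⟩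
  (ℕtoℚ 𝟙[ suc a ≤ j ] + ℕtoℚ (if a ≡ᵇ j then 1 else 0)) * x
    ≡⟨ cong (_* x) (trans (sym (ℕtoℚ-+ 𝟙[ suc a ≤ j ] (if a ≡ᵇ j then 1 else 0))) (cong ℕtoℚ (𝟙-≡ᵇ a j))) ⟩
  ℕtoℚ 𝟙[ a ≤ j ] * x ∎
  where
  open ≡-Reasoning
  if-scale : ∀ b → (if b then x else 0ℚ) ≡ ℕtoℚ (if b then 1 else 0) * x
  if-scale true  = sym (ℚ.*-identityˡ x)
  if-scale false = sym (ℚ.*-zeroˡ x)

∑-if : ∀ j a x f → ∑ j (λ u → if a ≡ᵇ u then x + f u else f u) ≡ ℕtoℚ 𝟙[ suc a ≤ j ] * x + ∑ j f
∑-if j a x f = begin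
  ∑ j (λ u → if a ≡ᵇ u then x + f u else f u)       ≡⟨ ∑-cong j (λ {u} _ → if-split (a ≡ᵇ u) (f u)) ⟩
  ∑ j (λ u → (if a ≡ᵇ u then x else 0ℚ) + f u)      ≡⟨ ∑-distrib j _ f ⟩
  ∑ j (λ u → if a ≡ᵇ u then x else 0ℚ) + ∑ j f      ≡⟨ cong (_+ ∑ j f) (∑-indicator j a x) ⟩
  ℕtoℚ 𝟙[ suc a ≤ j ] * x + ∑ j f                   ∎
  where
  open ≡-Reasoning
  if-split : ∀ b y → (if b then x + y else y) ≡ (if b then x else 0ℚ) + y
  if-split true  y = refl
  if-split false y = sym (ℚ.+-identityˡ y)

weighted : (Edge → ℕ) → List (Edge × ℚ) → ℚ
weighted w []            = 0ℚ
weighted w ((e , x) ∷ Z) = ℕtoℚ (w e) * x + weighted w Z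

∑-loadL : ∀ j Z → ∑ j (loadL Z) ≡ weighted (λ e → 𝟙[ suc (proj₁ e) ≤ j ]) Z
∑-loadL j []                  = ∑-zero j
∑-loadL j (((a , b) , x) ∷ Z) =
  trans (∑-if j a x (loadL Z)) (cong ((ℕtoℚ 𝟙[ suc a ≤ j ] * x) +_) (∑-loadL j Z))

∑-loadR : ∀ j Z → ∑ j (loadR Z) ≡ weighted (λ e → 𝟙[ suc (proj₂ e) ≤ j ]) Z
∑-loadR j []                  = ∑-zero j
∑-loadR j (((a , b) , x) ∷ Z) =
  trans (∑-if j b x (loadR Z)) (cong ((ℕtoℚ 𝟙[ suc b ≤ j ] * x) +_) (∑-loadR j Z))

weighted-++ : ∀ w Z Z′ → weighted w (Z ++ Z′) ≡ weighted w Z + weighted w Z′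
weighted-++ w []            Z′ = sym (ℚ.+-identityˡ _)
weighted-++ w ((e , x) ∷ Z) Z′ =
  trans (cong ((ℕtoℚ (w e) * x) +_) (weighted-++ w Z Z′))
        (sym (ℚ.+-assoc (ℕtoℚ (w e) * x) (weighted w Z) (weighted w Z′)))

weighted-+ : ∀ v w Z → weighted (λ e → v e ℕ.+ w e) Z ≡ weighted v Z + weighted w Z
weighted-+ v w []            = refl
weighted-+ v w ((e , x) ∷ Z) = begin
  ℕtoℚ (v e ℕ.+ w e) * x + weighted (λ e → v e ℕ.+ w e) Z
    ≡⟨ cong₂ _+_ (trans (cong (_* x) (ℕtoℚ-+ (v e) (w e))) (ℚ.*-distribʳ-+ x (ℕtoℚ (v e)) (ℕtoℚ (w e))))
                 (weighted-+ v w Z) ⟩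
  (ℕtoℚ (v e) * x + ℕtoℚ (w e) * x) + (weighted v Z + weighted w Z)
    ≡⟨ interchange (ℕtoℚ (v e) * x) (ℕtoℚ (w e) * x) (weighted v Z) (weighted w Z) ⟩
  (ℕtoℚ (v e) * x + weighted v Z) + (ℕtoℚ (w e) * x + weighted w Z) ∎
  where
  open ≡-Reasoning
  open import Algebra.Properties.CommutativeSemigroup (CommutativeMonoid.commutativeSemigroup ℚ.+-0-commutativeMonoid)
    using (interchange)

weighted-cong : ∀ {v w} Z → All (λ p → v (proj₁ p) ≡ w (proj₁ p)) Z → weighted v Z ≡ weighted w Z
weighted-cong []            []           = refl
weighted-cong ((e , x) ∷ Z) (v≡w ∷ v≡ws) = cong₂ (λ y z → ℕtoℚ y * x + z) v≡w (weighted-cong Z v≡ws)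

weighted-zero : ∀ Z → weighted (λ _ → 0) Z ≡ 0ℚ
weighted-zero []            = refl
weighted-zero ((e , x) ∷ Z) = trans (cong₂ _+_ (ℚ.*-zeroˡ x) (weighted-zero Z)) (ℚ.+-identityˡ 0ℚ)

value≡weighted-1 : ∀ Z → value Z ≡ weighted (λ _ → 1) Z
value≡weighted-1 []            = refl
value≡weighted-1 ((e , x) ∷ Z) = cong₂ _+_ (sym (ℚ.*-identityˡ x)) (value≡weighted-1 Z)

∑-weighted : ∀ K (w : ℕ → Edge → ℕ) Z → ∑ K (λ t → weighted (w t) Z) ≡ weighted (λ e → ℕ∑.∑ K (λ t → w t e)) Z
∑-weighted zero    w Z = trans (∑-zero 0) (sym (weighted-zero Z))
∑-weighted (suc K) w Z =
  trans (cong (_+ weighted (w K) Z) (∑-weighted K w Z)) (sym (weighted-+ (λ e → ℕ∑.∑ K (λ t → w t e)) (w K) Z))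

assignFrom-++ : ∀ A h xs ys → assignFrom A h (xs ++ ys) ≡ assignFrom A h xs ++ assignFrom A (h ++ xs) ys
assignFrom-++ A h []       ys = cong (λ h′ → assignFrom A h′ ys) (sym (List.++-identityʳ h))
assignFrom-++ A h (x ∷ xs) ys = cong ((x , A h x) ∷_) (trans (assignFrom-++ A (h ++ x ∷ []) xs ys)
  (cong (λ h′ → assignFrom A (h ++ x ∷ []) xs ++ assignFrom A h′ ys) (List.++-assoc h (x ∷ []) xs)))

assign-++ : ∀ A xs ys → assign A (xs ++ ys) ≡ assign A xs ++ assignFrom A xs ys
assign-++ A = assignFrom-++ A []

All-assignFrom : ∀ {P : Edge → Set} A h {xs} → All P xs → All (λ p → P (proj₁ p)) (assignFrom A h xs)
All-assignFrom A h []         = []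
All-assignFrom A h (px ∷ pxs) = px ∷ All-assignFrom A _ pxs

+-cancelʳ-≤ : ∀ {a b} c → a + c ≤ b + c → a ≤ b
+-cancelʳ-≤ {a} {b} c a+c≤b+c = subst₂ _≤_ (cancel a) (cancel b) (ℚ.+-monoˡ-≤ (- c) a+c≤b+c)
  where
  cancel : ∀ x → (x + c) + - c ≡ x
  cancel x = trans (ℚ.+-assoc x c (- c)) (trans (cong (x +_) (ℚ.+-inverseʳ c)) (ℚ.+-identityʳ x))

weighted-endsBelow≤ : ∀ {A} → Feasible A → ∀ {es} → ValidInput es → ∀ j →
  weighted (endsBelow j) (assign A es) ≤ ℕtoℚ (j ℕ.+ j)
weighted-endsBelow≤ {A} feasible {es} valid j = begin
  weighted (endsBelow j) Z
    ≡⟨ weighted-+ (λ e → 𝟙[ suc (proj₁ e) ≤ j ]) (λ e → 𝟙[ suc (proj₂ e) ≤ j ]) Z ⟩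
  weighted (λ e → 𝟙[ suc (proj₁ e) ≤ j ]) Z + weighted (λ e → 𝟙[ suc (proj₂ e) ≤ j ]) Z
    ≡⟨ sym (cong₂ _+_ (∑-loadL j Z) (∑-loadR j Z)) ⟩
  ∑ j (loadL Z) + ∑ j (loadR Z)
    ≤⟨ ℚ.+-mono-≤ (∑≤ℕtoℚ j loadL≤1) (∑≤ℕtoℚ j loadR≤1) ⟩
  ℕtoℚ j + ℕtoℚ j
    ≡⟨ sym (ℕtoℚ-+ j j) ⟩
  ℕtoℚ (j ℕ.+ j) ∎
  where
  open ℚ.≤-Reasoning
  Z = assign A es
  loadL≤1 = proj₁ (proj₂ (feasible es valid))
  loadR≤1 = proj₂ (proj₂ (feasible es valid))

pendant-threat : ∀ {α A} → Feasible A → Competitive α A →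
  ∀ Q P M j → All (λ e → endsBelow j e ≡ 1) P → ValidInput (Q ++ P) → IsMatching (Q ++ P) M →
  α * ℕtoℚ (length M) + value (assign A Q) ≤ ℕtoℚ (j ℕ.+ j) + weighted (endsAtLeast j) (assign A Q)
pendant-threat {α} {A} feasible competitive Q P M j below valid matching = begin
  α * ℕtoℚ (length M) + value ZQ
    ≤⟨ ℚ.+-monoˡ-≤ (value ZQ) (competitive (Q ++ P) valid M matching) ⟩
  value (assign A (Q ++ P)) + value ZQ
    ≡⟨ cong₂ _+_ (trans (value≡weighted-1 (assign A (Q ++ P))) (weighted-split (λ _ → 1))) (value≡weighted-1 ZQ) ⟩
  (q + weighted (λ _ → 1) ZP) + q
    ≡⟨ regroup q (weighted (λ _ → 1) ZP) (weighted (endsBelow j) ZQ) (weighted (endsAtLeast j) ZQ) twice ⟩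
  (weighted (endsBelow j) ZQ + weighted (λ _ → 1) ZP) + weighted (endsAtLeast j) ZQ
    ≡⟨ cong (_+ weighted (endsAtLeast j) ZQ) (sym below-total) ⟩
  weighted (endsBelow j) (assign A (Q ++ P)) + weighted (endsAtLeast j) ZQ
    ≤⟨ ℚ.+-monoˡ-≤ (weighted (endsAtLeast j) ZQ) (weighted-endsBelow≤ feasible valid j) ⟩
  ℕtoℚ (j ℕ.+ j) + weighted (endsAtLeast j) ZQ ∎
  where
  open ℚ.≤-Reasoning
  ZQ = assign A Q
  ZP = assignFrom A Q P
  q = weighted (λ _ → 1) ZQ
  weighted-split : ∀ w → weighted w (assign A (Q ++ P)) ≡ weighted w ZQ + weighted w ZP
  weighted-split w = trans (cong (weighted w) (assign-++ A Q P)) (weighted-++ w ZQ ZP)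
  below-total : weighted (endsBelow j) (assign A (Q ++ P)) ≡ weighted (endsBelow j) ZQ + weighted (λ _ → 1) ZP
  below-total = trans (weighted-split (endsBelow j))
    (cong (weighted (endsBelow j) ZQ +_) (weighted-cong ZP (All-assignFrom A Q below)))
  twice : q + q ≡ weighted (endsBelow j) ZQ + weighted (endsAtLeast j) ZQ
  twice = trans (sym (weighted-+ (λ _ → 1) (λ _ → 1) ZQ))
    (trans (weighted-cong ZQ (All.universal (λ (e , _) → sym (endsBelow+endsAtLeast≡2 j e)) ZQ))
           (weighted-+ (endsBelow j) (endsAtLeast j) ZQ))
  regroup : ∀ x y u v → x + x ≡ u + v → (x + y) + x ≡ (u + y) + v
  regroup x y u v x+x≡u+v = begin-equality
    (x + y) + x  ≡⟨ solve 2 (λ x y → (x :+ y) :+ x := (x :+ x) :+ y) refl x y ⟩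
    (x + x) + y  ≡⟨ cong (_+ y) x+x≡u+v ⟩
    (u + v) + y  ≡⟨ solve 3 (λ u v y → (u :+ v) :+ y := (u :+ y) :+ v) refl u v y ⟩
    (u + y) + v  ∎
    where open +-*-Solver using (solve; _:+_; _:=_)

module Stages {α A} (feasible : Feasible A) (competitive : Competitive α A) (k : ℕ) where

  open Adversary k

  final : List (Edge × ℚ)
  final = assign A (prefix stages)

  arrivedBy : ℕ → (Edge → ℕ) → Edge → ℕ
  arrivedBy t w e = 𝟙[ level e ≤ t ] ℕ.* w e

  arrivedBy-early : ∀ {t} w e → level e ℕ.< suc t → arrivedBy t w e ≡ w e
  arrivedBy-early w e (s≤s le) = ≡.trans (cong (ℕ._* w e) (𝟙-yes le)) (ℕ.+-identityʳ (w e))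

  arrivedBy-late : ∀ {t} w e → t ℕ.< level e → arrivedBy t w e ≡ 0
  arrivedBy-late w e lt = cong (ℕ._* w e) (𝟙-no (ℕ.<⇒≱ lt))

  weighted-arrivedBy : ∀ t d w →
    weighted (arrivedBy t w) (assign A (prefix (d ℕ.+ suc t))) ≡ weighted w (assign A (prefix (suc t)))
  weighted-arrivedBy t zero    w = weighted-cong (assign A (prefix (suc t)))
    (All-assignFrom A [] (All.map (λ {e} (early , _) → arrivedBy-early w e early) (prefix-edges (suc t))))
  weighted-arrivedBy t (suc d) w = begin
    weighted (arrivedBy t w) (assign A (prefix T ++ diagonal T))
      ≡⟨ cong (weighted (arrivedBy t w)) (assign-++ A (prefix T) (diagonal T)) ⟩
    weighted (arrivedBy t w) (assign A (prefix T) ++ Zᵀ)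
      ≡⟨ weighted-++ (arrivedBy t w) (assign A (prefix T)) Zᵀ ⟩
    weighted (arrivedBy t w) (assign A (prefix T)) + weighted (arrivedBy t w) Zᵀ
      ≡⟨ cong₂ _+_ (weighted-arrivedBy t d w) (trans (weighted-cong Zᵀ late) (weighted-zero Zᵀ)) ⟩
    weighted w (assign A (prefix (suc t))) + 0ℚ
      ≡⟨ ℚ.+-identityʳ _ ⟩
    weighted w (assign A (prefix (suc t))) ∎
    where
    open ≡-Reasoning
    T = d ℕ.+ suc t
    Zᵀ = assignFrom A (prefix T) (diagonal T)
    late : All (λ p → arrivedBy t w (proj₁ p) ≡ 0) Zᵀ
    late = All-assignFrom A (prefix T) (All.map
      (λ {e} (level≡T , _) → arrivedBy-late w e (≡.subst (t ℕ.<_) (sym level≡T) (ℕ.m≤n+m (suc t) d)))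
      (diagonal-edges T))

  weighted-final : ∀ {t} → t ℕ.< stages → ∀ w →
    weighted w (assign A (prefix (suc t))) ≡ weighted (arrivedBy t w) final
  weighted-final {t} t<N w = begin
    weighted w (assign A (prefix (suc t)))
      ≡⟨ sym (weighted-arrivedBy t (stages ∸ suc t) w) ⟩
    weighted (arrivedBy t w) (assign A (prefix (stages ∸ suc t ℕ.+ suc t)))
      ≡⟨ cong (λ T → weighted (arrivedBy t w) (assign A (prefix T))) (ℕ.m∸n+n≡m t<N) ⟩
    weighted (arrivedBy t w) final ∎
    where open ≡-Reasoning

  arrivedValue outsideValue : ℕ → ℚ
  arrivedValue t = weighted (arrivedBy t (λ _ → 1)) final
  outsideValue t = weighted (arrivedBy t (endsAtLeast (lo t))) final

  stage-bound : ∀ {t} → t ℕ.< stages →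
    α * ℕtoℚ (suc t) + arrivedValue t ≤ ℕtoℚ (lo t ℕ.+ lo t) + outsideValue t
  stage-bound {t} t<N = subst₂ _≤_
    (cong₂ _+_ (cong (λ m → α * ℕtoℚ m) (stage-length t<N))
               (trans (value≡weighted-1 (assign A (prefix (suc t)))) (weighted-final t<N (λ _ → 1))))
    (cong (ℕtoℚ (lo t ℕ.+ lo t) +_) (weighted-final t<N (endsAtLeast (lo t))))
    (pendant-threat {α} feasible competitive (prefix (suc t)) (pendants (lo t)) (pendants (lo t) ++ diagonal t)
       (lo t) (pendants-endsBelow (lo≤n t<N)) (prefix-pendants-unique (suc t) (lo≤n t<N)) (stage-matching t<N))

  ∑-outsideValue : ∑ stages outsideValue ≡ ∑ stages arrivedValue
  ∑-outsideValue = begin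
    ∑ stages outsideValue
      ≡⟨ ∑-weighted stages (λ t → arrivedBy t (endsAtLeast (lo t))) final ⟩
    weighted (λ e → ℕ∑.∑ stages (λ t → arrivedBy t (endsAtLeast (lo t)) e)) final
      ≡⟨ weighted-cong final
           (All-assignFrom A [] (All.map (λ (_ , core) → balanced core) (prefix-edges stages))) ⟩
    weighted (λ e → ℕ∑.∑ stages (λ t → arrivedBy t (λ _ → 1) e)) final
      ≡⟨ sym (∑-weighted stages (λ t → arrivedBy t (λ _ → 1)) final) ⟩
    ∑ stages arrivedValue ∎
    where
    open ≡-Reasoning
    balanced : ∀ {e} → Core e →
      ℕ∑.∑ stages (λ t → arrivedBy t (endsAtLeast (lo t)) e) ≡ ℕ∑.∑ stages (λ t → arrivedBy t (λ _ → 1) e)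
    balanced (a≤k , b≤k) = trans (balanced-count k a≤k b≤k) (ℕ∑.∑-cong stages (λ _ → sym (ℕ.*-identityʳ _)))

  total-bound : α * ℕtoℚ (n ℕ.* suc stages) ≤ ℕtoℚ (n ℕ.* suc n)
  total-bound = +-cancelʳ-≤ (∑ stages arrivedValue) (begin
    α * ℕtoℚ (n ℕ.* suc stages) + ∑ stages arrivedValue
      ≡⟨ cong (λ y → α * y + ∑ stages arrivedValue)
              (trans (cong ℕtoℚ (sym ∑-stage-size)) (ℕtoℚ-∑ stages suc)) ⟩
    α * ∑ stages (λ t → ℕtoℚ (suc t)) + ∑ stages arrivedValue
      ≡⟨ cong (_+ ∑ stages arrivedValue) (sym (∑-*ˡ stages α (λ t → ℕtoℚ (suc t)))) ⟩
    ∑ stages (λ t → α * ℕtoℚ (suc t)) + ∑ stages arrivedValue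
      ≡⟨ sym (∑-distrib stages (λ t → α * ℕtoℚ (suc t)) arrivedValue) ⟩
    ∑ stages (λ t → α * ℕtoℚ (suc t) + arrivedValue t)
      ≤⟨ ∑-mono stages stage-bound ⟩
    ∑ stages (λ t → ℕtoℚ (lo t ℕ.+ lo t) + outsideValue t)
      ≡⟨ ∑-distrib stages (λ t → ℕtoℚ (lo t ℕ.+ lo t)) outsideValue ⟩
    ∑ stages (λ t → ℕtoℚ (lo t ℕ.+ lo t)) + ∑ stages outsideValue
      ≡⟨ cong₂ _+_ (trans (sym (ℕtoℚ-∑ stages (λ t → lo t ℕ.+ lo t))) (cong ℕtoℚ ∑-threat-size)) ∑-outsideValue ⟩
    ℕtoℚ (n ℕ.* suc n) + ∑ stages arrivedValue ∎)
    where open ℚ.≤-Reasoning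

unreachable-ratio : ∀ δ m → 1ℚ ≤ δ * ℕtoℚ m → ¬ ((½ + δ) * ℕtoℚ (m ℕ.* suc (m ℕ.+ m)) ≤ ℕtoℚ (m ℕ.* suc m))
unreachable-ratio δ m 1≤δm bound = ℕ.<⇒≱ m<c+c (ℕtoℚ-cancel-≤ c+c≤m)
  where
  c = suc (m ℕ.+ m)
  X = m ℕ.* c
  Y = m ℕ.* suc m
  x = ℕtoℚ X
  Y+Y≡m+X : ∀ m → m ℕ.* suc m ℕ.+ m ℕ.* suc m ≡ m ℕ.+ m ℕ.* suc (m ℕ.+ m)
  Y+Y≡m+X = solve-∀
  doubled : (δ * x + δ * x) + x ≤ ℕtoℚ m + x
  doubled = subst₂ _≤_
    (+-*-Solver.solve 2 (λ d x → (con ½ :+ d) :* x :+ (con ½ :+ d) :* x := (d :* x :+ d :* x) :+ x) refl δ x)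
    (trans (sym (ℕtoℚ-+ Y Y)) (trans (cong ℕtoℚ (Y+Y≡m+X m)) (ℕtoℚ-+ m X)))
    (ℚ.+-mono-≤ bound bound)
    where open +-*-Solver using (_:+_; _:*_; _:=_; con)
  c≤δx : ℕtoℚ c ≤ δ * x
  c≤δx = subst₂ _≤_
    (ℚ.*-identityˡ (ℕtoℚ c)) (trans (ℚ.*-assoc δ (ℕtoℚ m) (ℕtoℚ c)) (cong (δ *_) (sym (ℕtoℚ-* m c))))
    (ℚ.*-monoʳ-≤-nonNeg (ℕtoℚ c) {{nonNegative (0≤ℕtoℚ c)}} 1≤δm)
  c+c≤m : ℕtoℚ (c ℕ.+ c) ≤ ℕtoℚ m
  c+c≤m = subst (_≤ ℕtoℚ m) (sym (ℕtoℚ-+ c c)) (ℚ.≤-trans (ℚ.+-mono-≤ c≤δx c≤δx) (+-cancelʳ-≤ x doubled))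
  m<c+c : m ℕ.< c ℕ.+ c
  m<c+c = ℕ.≤-trans (s≤s (ℕ.m≤m+n m m)) (ℕ.m≤m+n c c)

theorem1 : ∀ (δ : ℚ) → 0ℚ < δ → ∀ (A : OnlineAlg) → Feasible A →
    ¬ Competitive (½ + δ) A
theorem1 δ 0<δ A feasible competitive with archimedean δ 0<δ
... | k , 1≤δn = unreachable-ratio δ (suc k) 1≤δn (Stages.total-bound {½ + δ} feasible competitive k)
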